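{- Let $\mathcal{P},\mathcal{P}'$ be LR-vines and let $\varphi\colon\mathcal{P}\to\mathcal{P}'$ be a rank-preserving poset homomorphism that preserves joins of minimal pairs, i.e. whenever $x,y$ are minimal elements of $\mathcal{P}$ such that $x\vee y$ exists, then $\varphi(x)\vee\varphi(y)$ exists and $\varphi(x\vee y)=\varphi(x)\vee\varphi(y)$. Then $\varphi$ is join-preserving: for all $a,b\in\mathcal{P}$ such that $a\vee b$ exists, $\varphi(a)\vee\varphi(b)$ exists and $\varphi(a\vee b)=\varphi(a)\vee\varphi(b)$.
   Context: Posets are finite. A graded poset has a rank function $\operatorname{rk}\colon\mathcal{P}\to\mathbb{Z}_{>0}$ with $x<y\Rightarrow\operatorname{rk}(x)<\operatorname{rk}(y)$, $\operatorname{rk}(y)=\operatorname{rk}(x)+1$ when $y$ covers $x$, and minimal elements of rank $1$; $\mathcal{P}_i$ = elements of rank $i$, $\dim(\mathcal{P})$ = number of minimal elements, $\mathcal{E}(v)$ = elements covered by $v$. A vine is a graded poset in which every non-minimal element covers exactly two elements, any two distinct elements of the same rank are covered by at most one common element, and for each $1\le i\le\operatorname{rk}(\mathcal{P})$ the graph $F_i$ on $\mathcal{P}_i$ with edge set $\{\mathcal{E}(v)\mid v\in\mathcal{P}_{i+1}\}$ is a forest. An R-vine is a vine with $\operatorname{rk}(\mathcal{P})=\dim(\mathcal{P})$, each $F_i$ a tree, and proximity: distinct elements of the same rank $i\ge2$ covered by a common element cover a common element. An LR-vine is a vine all of whose principal ideals $\mathcal{P}_{\le v}$ (induced order and rank)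 are R-vines. A homomorphism is an order-preserving map; rank-preserving means $\operatorname{rk}'(\varphi(x))=\operatorname{rk}(x)$ for all $x$. The join $x\vee y$ is the least upper bound of $x$ and $y$, when it exists. -}

module Defs where

open import Data.Nat using (ℕ; zero; suc; _≤_; _<_)
open import Data.Fin using (Fin; fromℕ; inject₁) renaming (zero to fzero; suc to fsuc)
open import Data.Product using (Σ; ∃; ∃-syntax; _×_; _,_)
open import Data.Sum using (_⊎_)
open import Data.Unit using (⊤)
open import Relation.Nullary using (¬_)
open import Relation.Binary.PropositionalEquality using (_≡_; _≢_)
open import Relation.Binary.Structures using (IsPartialOrder)
open import Relation.Binary.Construct.Closure.ReflexiveTransitive using (Star)
open import Function.Definitions using (Injective)
open import Function.Bundles using (Bijection)
open import Relation.Binary.PropositionalEquality using (setoid)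
open import Function.Bundles using (_⤖_)

-- The grading axioms are stated separately (IsGradedOn), relative to a
-- subset S so that induced subposets (principal ideals) can be handled.

record RankedPoset : Set₁ where
  field
    Carrier        : Set
    _⊑_            : Carrier → Carrier → Set
    isPartialOrder : IsPartialOrder _≡_ _⊑_
    rk             : Carrier → ℕ

module _ (P : RankedPoset) where
  open RankedPoset P

  Finite : Set
  Finite = ∃[ n ] (Carrier ⤖ Fin n)

  _⊏_ : Carrier → Carrier → Set
  x ⊏ y = x ⊑ y × x ≢ y

  Subset : Set₁
  Subset = Carrier → Set

  Whole : Subset
  Whole _ = ⊤

  Below : Carrier → Subset
  Below v x = x ⊑ v

  CoversIn : Subset → Carrier → Carrier → Set
  CoversIn S x y = S x × S y × x ⊏ y × ¬ (∃[ z ] (S z × x ⊏ z × z ⊏ y))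

  MinimalIn : Subset → Carrier → Set
  MinimalIn S x = S x × (∀ y → S y → y ⊑ x → y ≡ x)

  IsGradedOn : Subset → Set
  IsGradedOn S =
      (∀ x → S x → 1 ≤ rk x)
    × (∀ x y → S x → S y → x ⊏ y → rk x < rk y)
    × (∀ x y → CoversIn S x y → rk y ≡ suc (rk x))
    × (∀ x → MinimalIn S x → rk x ≡ 1)

  -- rk(P) = maximal rank (0 for the empty poset)
  IsPosetRankOn : Subset → ℕ → Set
  IsPosetRankOn S r =
    (∀ x → S x → rk x ≤ r) × (r ≡ 0 ⊎ ∃[ x ] (S x × rk x ≡ r))

  HasDimOn : Subset → ℕ → Set
  HasDimOn S d =
    Σ (Fin d → Carrier) λ f →
        Injective _≡_ _≡_ f
      × (∀ j → MinimalIn S (f j))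
      × (∀ x → MinimalIn S x → ∃[ j ] (f j ≡ x))

  -- the graph F_i on P_i: {x,y} is an edge iff {x,y} = E(v) for some v of rank i+1
  Edge : Subset → ℕ → Carrier → Carrier → Set
  Edge S i x y =
      S x × S y × rk x ≡ i × rk y ≡ i × x ≢ y
    × ∃[ v ] (S v × rk v ≡ suc i × CoversIn S x v × CoversIn S y v
               × (∀ c → CoversIn S c v → c ≡ x ⊎ c ≡ y))

  -- no cycle x₀ x₁ … x_{k+2} x₀ with k+3 ≥ 3 distinct vertices
  Acyclic : (Carrier → Carrier → Set) → Set
  Acyclic E = ∀ k (c : Fin (suc (suc (suc k))) → Carrier) → Injective _≡_ _≡_ c →
    ¬ ((∀ (j : Fin (suc (suc k))) → E (c (inject₁ j)) (c (fsuc j)))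
       × E (c (fromℕ (suc (suc k)))) (c fzero))

  ConnectedOn : Subset → ℕ → (Carrier → Carrier → Set) → Set
  ConnectedOn S i E = ∀ x y → S x → S y → rk x ≡ i → rk y ≡ i → Star E x y

  IsVineOn : Subset → Set
  IsVineOn S =
      IsGradedOn S
    × (∀ v → S v → ¬ MinimalIn S v →
         ∃[ a ] ∃[ b ] (a ≢ b × CoversIn S a v × CoversIn S b v
                        × (∀ c → CoversIn S c v → c ≡ a ⊎ c ≡ b)))
    × (∀ x y v w → x ≢ y → rk x ≡ rk y →
         CoversIn S x v → CoversIn S y v → CoversIn S x w → CoversIn S y w → v ≡ w)
    × (∀ r → IsPosetRankOn S r → ∀ i → 1 ≤ i → i ≤ r → Acyclic (Edge S i))

  IsRVineOn : Subset → Set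
  IsRVineOn S =
      IsVineOn S
    × (∃[ r ] (IsPosetRankOn S r × HasDimOn S r))
    × (∀ r → IsPosetRankOn S r → ∀ i → 1 ≤ i → i ≤ r →
         ConnectedOn S i (Edge S i) × Acyclic (Edge S i))
    × (∀ x y v → x ≢ y → rk x ≡ rk y → 2 ≤ rk x →
         CoversIn S x v → CoversIn S y v → ∃[ z ] (CoversIn S z x × CoversIn S z y))

  IsVine : Set
  IsVine = IsVineOn Whole

  IsRVine : Set
  IsRVine = IsRVineOn Whole

  IsLRVine : Set
  IsLRVine = Finite × IsVine × (∀ v → IsRVineOn (Below v))

  Minimal : Carrier → Set
  Minimal = MinimalIn Whole

  IsJoin : Carrier → Carrier → Carrier → Set
  IsJoin x y j = x ⊑ j × y ⊑ j × (∀ u → x ⊑ u → y ⊑ u → j ⊑ u)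

module _ (P Q : RankedPoset) where
  private
    module P = RankedPoset P
    module Q = RankedPoset Q

  IsHomomorphism : (P.Carrier → Q.Carrier) → Set
  IsHomomorphism φ = ∀ x y → x P.⊑ y → φ x Q.⊑ φ y

  RankPreserving : (P.Carrier → Q.Carrier) → Set
  RankPreserving φ = ∀ x → Q.rk (φ x) ≡ P.rk x

  PreservesMinimalJoins : (P.Carrier → Q.Carrier) → Set
  PreservesMinimalJoins φ = ∀ x y j → Minimal P x → Minimal P y →
    IsJoin P x y j → IsJoin Q (φ x) (φ y) (φ j)

  PreservesJoins : (P.Carrier → Q.Carrier) → Set
  PreservesJoins φ = ∀ x y j → IsJoin P x y j → IsJoin Q (φ x) (φ y) (φ j)

-- If a and b are comparable the claim is immediate. Otherwise j = a ∨ b covers two distinct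
-- elements c_a ≥ a and c_b ≥ b, and there are minimal x ≤ a with x ≰ c_b and y ≤ b with
-- y ≰ c_a. Then x ∨ y = j: for an upper bound u of x and y, the common lower bounds of j and
-- u have a greatest element m, because inside ↓j and ↓u every level is a tree sitting in the
-- forest F_i of P, so two distinct elements of a level of ↓j ∩ ↓u have a common upper cover
-- there; and m < j would put m, hence y or x, below c_a or c_b. Therefore
-- φ(j) = φ(x) ∨ φ(y) lies below every common upper bound of φ(a) and φ(b). The classical steps run in the double-negation monad and
-- are discharged at the end because _⊑_ is decidable on a finite vine.
module Submission where

open import Defs hiding (_⊏_)
open import Data.Empty using (⊥; ⊥-elim)
open import Data.Fin using (Fin; fromℕ; inject₁) renaming (zero to fzero; suc to fsuc)
open import Data.Fin.Properties using () renaming (_≟_ to _≟ᶠ_)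
open import Data.List using (tabulate)
open import Data.List.Extrema.Nat using (argmax; f[xs]≤f[argmax])
open import Data.List.Membership.Propositional.Properties using (∈-tabulate⁺)
import Data.List.Relation.Unary.All as All
open import Data.Nat using (ℕ; zero; suc; _≤_; _<_; _∸_) renaming (_≟_ to _≟ℕ_)
open import Data.Nat.Induction using (<-wellFounded)
open import Data.Nat.Properties
  using ( ≤-refl; ≤-trans; <⇒≤; <⇒≱; ≮⇒≥; ≤∧≢⇒<; ≤-antisym; ≤-pred; ≤-reflexive; ∸-monoʳ-<
        ; suc-injective)
open import Data.Product using (Σ; Σ-syntax; ∃-syntax; _×_; _,_; proj₁; proj₂)
open import Data.Sum using (_⊎_; inj₁; inj₂; [_,_]; swap)
open import Data.Unit using (⊤; tt)
open import Effect.Monad using (RawMonad)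
open import Function.Bundles using (Bijection; _⤖_)
open import Function.Definitions using (Injective)
open import Induction.WellFounded as WF using ()
open import Level using (0ℓ)
open import Relation.Binary.Construct.Closure.ReflexiveTransitive
  using (Star; ε; _◅_; _◅◅_; reverse)
import Relation.Binary.Construct.On as On
open import Relation.Binary.Definitions using (DecidableEquality; Symmetric)
open import Relation.Binary.PropositionalEquality using (_≡_; _≢_; refl; sym; trans; cong; subst)
open import Relation.Binary.Structures using (IsPartialOrder)
open import Relation.Nullary using (¬_; Dec; yes; no)
open import Relation.Nullary.Decidable using (via-injection; decidable-stable; ¬¬-excluded-middle)
open import Relation.Nullary.Negation using (¬¬-Monad; ¬¬-map)

open RawMonad (¬¬-Monad {a = 0ℓ}) using (_>>=_; pure)

measure-rec : {A : Set} (f : A → ℕ) (Q : A → Set) →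
              (∀ x → (∀ {y} → f y < f x → Q y) → Q x) → ∀ x → Q x
measure-rec f = WF.All.wfRec (On.wellFounded f <-wellFounded) 0ℓ

finite⇒maximum : {A : Set} {n : ℕ} → A ⤖ Fin n → (f : A → ℕ) → A → Σ[ m ∈ A ] (∀ x → f x ≤ f m)
finite⇒maximum {A} bij f x₀ = m , f≤f[m]
  where
    open Bijection bij using (to; injective; strictlySurjective)
    enumerate : Fin _ → A
    enumerate i = proj₁ (strictlySurjective i)
    m : A
    m = argmax f x₀ (tabulate enumerate)
    f≤f[m] : ∀ x → f x ≤ f m
    f≤f[m] x = subst (λ y → f y ≤ f m) (injective (proj₂ (strictlySurjective (to x))))
      (All.lookup (f[xs]≤f[argmax] {f = f} x₀ (tabulate enumerate)) (∈-tabulate⁺ (to x)))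

¬¬-maximal : {A : Set} (f : A → ℕ) {B : ℕ} (I : A → Set) → (∀ x → I x → f x ≤ B) →
             ∀ {x} → I x → ¬ ¬ (Σ[ m ∈ A ] (I m × (∀ y → I y → f y ≤ f m)))
¬¬-maximal {A} f {B} I bounded {x} Ix = measure-rec (λ x → B ∸ f x) Climb climb x Ix
  where
    Climb : A → Set
    Climb x = I x → ¬ ¬ (Σ[ m ∈ A ] (I m × (∀ y → I y → f y ≤ f m)))
    climb : ∀ x → (∀ {y} → B ∸ f y < B ∸ f x → Climb y) → Climb x
    climb x ih Ix = do
      yes (y , Iy , fx<fy) ← ¬¬-excluded-middle {A = Σ[ y ∈ A ] (I y × f x < f y)}
        where no ¬higher → pure (x , Ix , λ y Iy → ≮⇒≥ (λ fx<fy → ¬higher (y , Iy , fx<fy)))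
      ih (∸-monoʳ-< fx<fy (bounded y Iy)) Iy

module Walks (P : RankedPoset) (_≟_ : DecidableEquality (RankedPoset.Carrier P)) where
  open RankedPoset P using (Carrier)

  private
    variable
      R S : Carrier → Carrier → Set
      w x y y′ z : Carrier
      m n : ℕ

  data Path (R : Carrier → Carrier → Set) : Carrier → Carrier → ℕ → Set where
    []  : Path R x x 0
    _∷_ : R x y → Path R y z n → Path R x z (suc n)

  vertex : Path R x z n → Fin (suc n) → Carrier
  vertex {x = x} _ fzero = x
  vertex [] (fsuc ())
  vertex (_ ∷ p) (fsuc i) = vertex p i

  _∉_ : Carrier → Path R x z n → Set
  w ∉ p = ∀ i → vertex p i ≢ w

  Simple : Path R x z n → Set
  Simple [] = ⊤
  Simple (_∷_ {x = x} _ p) = x ∉ p × Simple p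

  vertex-last : (p : Path R x z n) → vertex p (fromℕ n) ≡ z
  vertex-last [] = refl
  vertex-last (_ ∷ p) = vertex-last p

  vertex-step : (p : Path R x z n) (i : Fin n) → R (vertex p (inject₁ i)) (vertex p (fsuc i))
  vertex-step (e ∷ _) fzero = e
  vertex-step (_ ∷ p) (fsuc i) = vertex-step p i

  simple⇒vertex-injective : (p : Path R x z n) → Simple p → Injective _≡_ _≡_ (vertex p)
  simple⇒vertex-injective p _ {fzero} {fzero} _ = refl
  simple⇒vertex-injective [] _ {fzero} {fsuc ()}
  simple⇒vertex-injective [] _ {fsuc ()}
  simple⇒vertex-injective (_ ∷ p) (x∉p , _) {fzero} {fsuc j} eq = ⊥-elim (x∉p j (sym eq))
  simple⇒vertex-injective (_ ∷ p) (x∉p , _) {fsuc i} {fzero} eq = ⊥-elim (x∉p i eq)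
  simple⇒vertex-injective (_ ∷ p) (_ , simple) {fsuc i} {fsuc j} eq =
    cong fsuc (simple⇒vertex-injective p simple eq)

  suffix : (p : Path R x z n) → Simple p → (i : Fin (suc n)) →
           ∃[ m ] Σ (Path R (vertex p i) z m) Simple
  suffix p simple fzero = _ , p , simple
  suffix [] _ (fsuc ())
  suffix (_ ∷ p) (_ , simple) (fsuc i) = suffix p simple i

  find : (w : Carrier) (p : Path R x z n) → (∃[ i ] vertex p i ≡ w) ⊎ w ∉ p
  find {x = x} w p with x ≟ w
  ... | yes x≡w = inj₁ (fzero , x≡w)
  find w [] | no x≢w = inj₂ λ { fzero → x≢w }
  find w (_ ∷ p) | no x≢w with find w p
  ... | inj₁ (i , eq) = inj₁ (fsuc i , eq)
  ... | inj₂ w∉p = inj₂ λ { fzero → x≢w ; (fsuc i) → w∉p i }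

  loop-erase : Star R x z → ∃[ n ] Σ (Path R x z n) Simple
  loop-erase ε = 0 , [] , tt
  loop-erase {x = x} (e ◅ walk) with loop-erase walk
  ... | n , p , simple with find x p
  ...   | inj₁ (i , eq) = subst (λ y → ∃[ m ] Σ (Path _ y _ m) Simple) eq (suffix p simple i)
  ...   | inj₂ x∉p = suc n , e ∷ p , x∉p , simple

  map : (∀ {a b} → R a b → S a b) → Path R x z n → Path S x z n
  map f [] = []
  map f (e ∷ p) = f e ∷ map f p

  vertex-map : (f : ∀ {a b} → R a b → S a b) (p : Path R x z n) (i : Fin (suc n)) →
               vertex (map f p) i ≡ vertex p i
  vertex-map f p fzero = refl
  vertex-map f [] (fsuc ())
  vertex-map f (_ ∷ p) (fsuc i) = vertex-map f p i

  ∉-map : (f : ∀ {a b} → R a b → S a b) (p : Path R x z n) → w ∉ p → w ∉ map f p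
  ∉-map f p w∉p i eq = w∉p i (subst (_≡ _) (vertex-map f p i) eq)

  simple-map : (f : ∀ {a b} → R a b → S a b) (p : Path R x z n) → Simple p → Simple (map f p)
  simple-map f [] _ = tt
  simple-map f (_ ∷ p) (x∉p , simple) = ∉-map f p x∉p , simple-map f p simple

  Avoiding : (Carrier → Carrier → Set) → Carrier → Carrier → Carrier → Set
  Avoiding R w a b = R a b × a ≢ w × b ≢ w

  ∉⇒avoiding : (p : Path R x z n) → w ∉ p → Star (Avoiding R w) x z
  ∉⇒avoiding [] _ = ε
  ∉⇒avoiding (e ∷ p) w∉ = (e , w∉ fzero , w∉ (fsuc fzero)) ◅ ∉⇒avoiding p (λ i → w∉ (fsuc i))

  avoiding⇒∉ : (p : Path (Avoiding R w) x z n) → x ≢ w → w ∉ p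
  avoiding⇒∉ p x≢w fzero = x≢w
  avoiding⇒∉ [] _ (fsuc ())
  avoiding⇒∉ ((_ , _ , y≢w) ∷ p) _ (fsuc i) = avoiding⇒∉ p y≢w i

  -- If y ≢ y′, then y ⇝ z ⇝ y′ is a walk avoiding x, and its loop erasure closes with x–y
  -- and y′–x into a cycle.
  first-steps-agree : Acyclic P R → Symmetric R →
                      R x y → (ys : Path R y z m) → x ∉ ys →
                      R x y′ → (ys′ : Path R y′ z n) → x ∉ ys′ → y ≡ y′
  first-steps-agree {R = R} {x = x} {y = y} {y′ = y′} acyclic R-sym xy ys x∉ys xy′ ys′ x∉ys′
    with y ≟ y′
  ... | yes y≡y′ = y≡y′
  ... | no y≢y′ = ⊥-elim (no-cycle (loop-erase bypass))
    where
      avoiding-sym : Symmetric (Avoiding R x)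
      avoiding-sym (e , a≢x , b≢x) = R-sym e , b≢x , a≢x
      bypass : Star (Avoiding R x) y y′
      bypass = ∉⇒avoiding ys x∉ys ◅◅ reverse avoiding-sym (∉⇒avoiding ys′ x∉ys′)
      no-cycle : ∃[ k ] Σ (Path (Avoiding R x) y y′ k) Simple → ⊥
      no-cycle (zero , [] , _) = y≢y′ refl
      no-cycle (suc k , p , simple) =
        acyclic k (vertex cycle) (simple⇒vertex-injective cycle simple-cycle)
          (vertex-step cycle , closing)
        where
          cycle : Path R x y′ (suc (suc k))
          cycle = xy ∷ map proj₁ p
          simple-cycle : Simple cycle
          simple-cycle = ∉-map proj₁ p (avoiding⇒∉ p (x∉ys fzero)) , simple-map proj₁ p simple
          closing : R (vertex cycle (fromℕ (suc (suc k)))) (vertex cycle fzero)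
          closing = subst (λ v → R v x) (sym (vertex-last cycle)) (R-sym xy′)

module LRVine (P : RankedPoset) (isLRVine : IsLRVine P) where
  open RankedPoset P
  open IsPartialOrder isPartialOrder public using ()
    renaming (refl to ⊑-refl; trans to ⊑-trans; antisym to ⊑-antisym)

  private
    variable
      a b c c′ j m u v w w′ x y z : Carrier
      n : ℕ

    finite : Finite P
    finite = proj₁ isLRVine

    vine : IsVine P
    vine = proj₁ (proj₂ isLRVine)

    graded : IsGradedOn P (Whole P)
    graded = proj₁ vine

  _≟_ : DecidableEquality Carrier
  _≟_ = via-injection (Bijection.injection (proj₂ finite)) _≟ᶠ_

  open Walks P _≟_

  _⊏_ : Carrier → Carrier → Set
  _⊏_ = Defs._⊏_ P

  _⋖_ : Carrier → Carrier → Set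
  _⋖_ = CoversIn P (Whole P)

  F : ℕ → Carrier → Carrier → Set
  F = Edge P (Whole P)

  1≤rk : ∀ x → 1 ≤ rk x
  1≤rk x = proj₁ graded x tt

  ⊏⇒rk< : x ⊏ y → rk x < rk y
  ⊏⇒rk< x⊏y = proj₁ (proj₂ graded) _ _ tt tt x⊏y

  ⋖⇒rk≡suc : x ⋖ y → rk y ≡ suc (rk x)
  ⋖⇒rk≡suc x⋖y = proj₁ (proj₂ (proj₂ graded)) _ _ x⋖y

  minimal⇒rk≡1 : Minimal P x → rk x ≡ 1
  minimal⇒rk≡1 min = proj₂ (proj₂ (proj₂ graded)) _ min

  ⋖⇒⊏ : x ⋖ y → x ⊏ y
  ⋖⇒⊏ (_ , _ , x⊏y , _) = x⊏y

  ⋖⇒⊑ : x ⋖ y → x ⊑ y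
  ⋖⇒⊑ x⋖y = proj₁ (⋖⇒⊏ x⋖y)

  ⋖⇒rk< : x ⋖ y → rk x < rk y
  ⋖⇒rk< x⋖y = ⊏⇒rk< (⋖⇒⊏ x⋖y)

  ⊑⇒rk≤ : x ⊑ y → rk x ≤ rk y
  ⊑⇒rk≤ {x} {y} x⊑y with x ≟ y
  ... | yes refl = ≤-refl
  ... | no x≢y = <⇒≤ (⊏⇒rk< (x⊑y , x≢y))

  ⊏⇒¬minimal : x ⊏ y → ¬ Minimal P y
  ⊏⇒¬minimal (x⊑y , x≢y) (_ , least) = x≢y (least _ tt x⊑y)

  minimal? : ∀ x → Dec (Minimal P x)
  minimal? x with rk x ≟ℕ 1
  ... | no rk≢1 = no (λ min → rk≢1 (minimal⇒rk≡1 min))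
  ... | yes rk≡1 = yes (tt , λ y _ y⊑x → bottom y⊑x)
    where
      bottom : y ⊑ x → y ≡ x
      bottom {y} y⊑x with y ≟ x
      ... | yes y≡x = y≡x
      ... | no y≢x = ⊥-elim (<⇒≱ (⊏⇒rk< (y⊑x , y≢x)) (≤-trans (≤-reflexive rk≡1) (1≤rk y)))

  lower-covers : ¬ Minimal P v →
                 Σ[ a ∈ Carrier ] Σ[ b ∈ Carrier ]
                   (a ≢ b × a ⋖ v × b ⋖ v × (∀ c → c ⋖ v → c ≡ a ⊎ c ≡ b))
  lower-covers ¬min = proj₁ (proj₂ vine) _ tt ¬min

  lower-covers-exhaustive : a ≢ b → a ⋖ v → b ⋖ v → c ⋖ v → c ≡ a ⊎ c ≡ b
  lower-covers-exhaustive {a} {b} {v} {c} a≢b a⋖v b⋖v c⋖v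
    with lower-covers (⊏⇒¬minimal (⋖⇒⊏ a⋖v))
  ... | p , q , _ , _ , _ , only with only c c⋖v | only a a⋖v | only b b⋖v
  ... | inj₁ refl | inj₁ refl | _         = inj₁ refl
  ... | inj₁ refl | inj₂ refl | inj₁ refl = inj₂ refl
  ... | inj₁ refl | inj₂ refl | inj₂ refl = ⊥-elim (a≢b refl)
  ... | inj₂ refl | inj₂ refl | _         = inj₁ refl
  ... | inj₂ refl | inj₁ refl | inj₂ refl = inj₂ refl
  ... | inj₂ refl | inj₁ refl | inj₁ refl = ⊥-elim (a≢b refl)

  ⋖-same-rank : a ⋖ v → b ⋖ v → rk a ≡ rk b
  ⋖-same-rank a⋖v b⋖v = suc-injective (trans (sym (⋖⇒rk≡suc a⋖v)) (⋖⇒rk≡suc b⋖v))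

  upper-cover-unique : a ≢ b → a ⋖ v → b ⋖ v → a ⋖ w → b ⋖ w → v ≡ w
  upper-cover-unique a≢b a⋖v b⋖v =
    proj₁ (proj₂ (proj₂ vine)) _ _ _ _ a≢b (⋖-same-rank a⋖v b⋖v) a⋖v b⋖v

  <⇒≤-below-cover : n < rk v → a ⋖ v → n ≤ rk a
  <⇒≤-below-cover n<rk a⋖v = ≤-pred (≤-trans n<rk (≤-reflexive (⋖⇒rk≡suc a⋖v)))

  element-of-rank-below : ∀ m i → 1 ≤ i → i ≤ rk m → Σ[ w ∈ Carrier ] (w ⊑ m × rk w ≡ i)
  element-of-rank-below = measure-rec rk Descent descend
    where
      Descent : Carrier → Set
      Descent m = ∀ i → 1 ≤ i → i ≤ rk m → Σ[ w ∈ Carrier ] (w ⊑ m × rk w ≡ i)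
      descend : ∀ m → (∀ {a} → rk a < rk m → Descent a) → Descent m
      descend m ih i 1≤i i≤rk with rk m ≟ℕ i
      ... | yes rk≡i = m , ⊑-refl , rk≡i
      ... | no rk≢i with minimal? m
      ...   | yes min = ⊥-elim (rk≢i (trans (minimal⇒rk≡1 min)
                          (≤-antisym 1≤i (≤-trans i≤rk (≤-reflexive (minimal⇒rk≡1 min))))))
      ...   | no ¬min with lower-covers ¬min
      ...     | a , _ , _ , a⋖m , _
        with ih (⋖⇒rk< a⋖m) i 1≤i (<⇒≤-below-cover (≤∧≢⇒< i≤rk (λ i≡rk → rk≢i (sym i≡rk))) a⋖m)
      ...       | w , w⊑a , rk≡i = w , ⊑-trans w⊑a (⋖⇒⊑ a⋖m) , rk≡i

  ¬¬-⊑-lower-cover : x ⊏ v → ¬ ¬ (Σ[ c ∈ Carrier ] (c ⋖ v × x ⊑ c))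
  ¬¬-⊑-lower-cover {x} {v} x⊏v = do
    (c , (x⊑c , c⊏v) , maximal) ←
      ¬¬-maximal rk Between (λ _ (_ , z⊏v) → <⇒≤ (⊏⇒rk< z⊏v)) (⊑-refl , x⊏v)
    pure (c , (tt , tt , c⊏v , λ (z , _ , c⊏z , z⊏v) →
                 <⇒≱ (⊏⇒rk< c⊏z) (maximal z (⊑-trans x⊑c (proj₁ c⊏z) , z⊏v))) , x⊑c)
    where
      Between : Carrier → Set
      Between z = x ⊑ z × z ⊏ v

  _⊑?_ : ∀ x v → Dec (x ⊑ v)
  x ⊑? v = measure-rec rk (λ v → Dec (x ⊑ v)) decide v
    where
      decide : ∀ v → (∀ {c} → rk c < rk v → Dec (x ⊑ c)) → Dec (x ⊑ v)
      decide v ih with x ≟ v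
      ... | yes refl = yes ⊑-refl
      ... | no x≢v with minimal? v
      ...   | yes (_ , least) = no (λ x⊑v → x≢v (least x tt x⊑v))
      ...   | no ¬min with lower-covers ¬min
      ...     | a , b , _ , a⋖v , b⋖v , only with ih (⋖⇒rk< a⋖v) | ih (⋖⇒rk< b⋖v)
      ...       | yes x⊑a | _ = yes (⊑-trans x⊑a (⋖⇒⊑ a⋖v))
      ...       | no _ | yes x⊑b = yes (⊑-trans x⊑b (⋖⇒⊑ b⋖v))
      ...       | no x⋢a | no x⋢b = no λ x⊑v → ¬¬-⊑-lower-cover (x⊑v , x≢v) λ (c , c⋖v , x⊑c) →
                    [ (λ { refl → x⋢a x⊑c }) , (λ { refl → x⋢b x⊑c }) ] (only c c⋖v)

  F-acyclic : ∀ x → Acyclic P (F (rk x))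
  F-acyclic x with finite⇒maximum (proj₂ finite) rk x
  ... | top , rk≤top =
    proj₂ (proj₂ (proj₂ vine)) (rk top) ((λ y _ → rk≤top y) , inj₂ (top , tt , refl))
      (rk x) (1≤rk x) (rk≤top x)

  F-sym : Symmetric (F n)
  F-sym (_ , _ , rx , ry , x≢y , v , _ , rv , x⋖v , y⋖v , only) =
    tt , tt , ry , rx , (λ y≡x → x≢y (sym y≡x)) , v , tt , rv , y⋖v , x⋖v ,
    λ c c⋖v → swap (only c c⋖v)

  ⋖-pair⇒F : a ≢ b → a ⋖ v → b ⋖ v → F (rk a) a b
  ⋖-pair⇒F a≢b a⋖v b⋖v =
    tt , tt , refl , sym (⋖-same-rank a⋖v b⋖v) , a≢b ,
    _ , tt , ⋖⇒rk≡suc a⋖v , a⋖v , b⋖v , λ c → lower-covers-exhaustive a≢b a⋖v b⋖v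

  ideal-⋖⇒⋖ : CoversIn P (Below P u) x v → x ⋖ v
  ideal-⋖⇒⋖ (_ , v⊑u , x⊏v , nothing-between) =
    tt , tt , x⊏v ,
    λ (z , _ , x⊏z , z⊏v) → nothing-between (z , ⊑-trans (proj₁ z⊏v) v⊑u , x⊏z , z⊏v)

  ⋖⇒ideal-⋖ : x ⋖ v → v ⊑ u → CoversIn P (Below P u) x v
  ⋖⇒ideal-⋖ (_ , _ , x⊏v , nothing-between) v⊑u =
    ⊑-trans (proj₁ x⊏v) v⊑u , v⊑u , x⊏v ,
    λ (z , _ , x⊏z , z⊏v) → nothing-between (z , tt , x⊏z , z⊏v)

  ideal-F⇒F : Edge P (Below P u) n x y → F n x y
  ideal-F⇒F (_ , _ , rx , ry , x≢y , v , v⊑u , rv , x⋖v , y⋖v , only) =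
    tt , tt , rx , ry , x≢y , v , tt , rv , ideal-⋖⇒⋖ x⋖v , ideal-⋖⇒⋖ y⋖v ,
    λ c c⋖v → only c (⋖⇒ideal-⋖ c⋖v v⊑u)

  ideal-connected : w ⊑ u → w′ ⊑ u → rk w ≡ rk w′ → Star (Edge P (Below P u) (rk w)) w w′
  ideal-connected {w} {u} {w′} w⊑u w′⊑u rk≡ =
    proj₁ (proj₁ (proj₂ (proj₂ (proj₂ (proj₂ isLRVine) u)))
                 (rk u) u-rank (rk w) (1≤rk w) (⊑⇒rk≤ w⊑u))
      w w′ w⊑u w′⊑u refl (sym rk≡)
    where
      u-rank : IsPosetRankOn P (Below P u) (rk u)
      u-rank = (λ _ → ⊑⇒rk≤) , inj₂ (u , ⊑-refl , refl)

  first-step-in-ideal : x ≢ z → x ⊑ u → z ⊑ u → rk x ≡ rk z →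
    Σ[ y ∈ Carrier ] Σ[ v ∈ Carrier ]
      (y ⊑ u × v ⊑ u × x ⋖ v × y ⋖ v × F (rk x) x y × ∃[ n ] Σ (Path (F (rk x)) y z n) (x ∉_))
  first-step-in-ideal x≢z x⊑u z⊑u rk≡ with loop-erase (ideal-connected x⊑u z⊑u rk≡)
  ... | zero , [] , _ = ⊥-elim (x≢z refl)
  ... | suc n , e@(_ , y⊑u , _ , _ , _ , v , v⊑u , _ , x⋖v , y⋖v , _) ∷ ys , x∉ys , _ =
    _ , v , y⊑u , v⊑u , ideal-⋖⇒⋖ x⋖v , ideal-⋖⇒⋖ y⋖v , ideal-F⇒F e ,
    n , map ideal-F⇒F ys , ∉-map ideal-F⇒F ys x∉ys

  -- A walk from a to b inside ↓u must leave a along the edge a–b of the forest F_{rk a}.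
  lower-covers-join : a ≢ b → a ⋖ v → b ⋖ v → IsJoin P a b v
  lower-covers-join {a} {b} {v} a≢b a⋖v b⋖v = ⋖⇒⊑ a⋖v , ⋖⇒⊑ b⋖v , least
    where
      least : ∀ u → a ⊑ u → b ⊑ u → v ⊑ u
      least u a⊑u b⊑u with first-step-in-ideal a≢b a⊑u b⊑u (⋖-same-rank a⋖v b⋖v)
      ... | y , w , _ , w⊑u , a⋖w , y⋖w , a–y , _ , ys , a∉ys =
        subst (_⊑ u) (sym (upper-cover-unique a≢b a⋖v b⋖v a⋖w (subst (_⋖ w) y≡b y⋖w))) w⊑u
        where
          y≡b : y ≡ b
          y≡b = first-steps-agree (F-acyclic a) F-sym a–y ys a∉ys
                  (⋖-pair⇒F a≢b a⋖v b⋖v) [] (λ { fzero b≡a → a≢b (sym b≡a) })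

  upper-cover-below-both : w ≢ w′ → rk w ≡ rk w′ → w ⊑ j → w′ ⊑ j → w ⊑ u → w′ ⊑ u →
                           Σ[ v ∈ Carrier ] (w ⋖ v × v ⊑ j × v ⊑ u)
  upper-cover-below-both {u = u} w≢w′ rk≡ w⊑j w′⊑j w⊑u w′⊑u
    with first-step-in-ideal w≢w′ w⊑j w′⊑j rk≡ | first-step-in-ideal w≢w′ w⊑u w′⊑u rk≡
  ... | p , v , _ , v⊑j , w⋖v , p⋖v , w–p@(_ , _ , _ , _ , w≢p , _) , _ , ps , w∉ps
      | q , _ , q⊑u , _ , _ , _ , w–q , _ , qs , w∉qs =
    v , w⋖v , v⊑j , proj₂ (proj₂ (lower-covers-join w≢p w⋖v p⋖v)) u w⊑u (subst (_⊑ u) (sym p≡q) q⊑u)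
    where
      p≡q : p ≡ q
      p≡q = first-steps-agree (F-acyclic _) F-sym w–p ps w∉ps w–q qs w∉qs

  maximal-rank⇒greatest-common-lower-bound :
    m ⊑ j → m ⊑ u → (∀ w → w ⊑ j → w ⊑ u → rk w ≤ rk m) → ∀ w → w ⊑ j → w ⊑ u → w ⊑ m
  maximal-rank⇒greatest-common-lower-bound {m} {j} {u} m⊑j m⊑u maximal =
    measure-rec (λ w → rk m ∸ rk w) Below-m climb
    where
      Below-m : Carrier → Set
      Below-m w = w ⊑ j → w ⊑ u → w ⊑ m
      climb : ∀ w → (∀ {v} → rk m ∸ rk v < rk m ∸ rk w → Below-m v) → Below-m w
      climb w ih w⊑j w⊑u with element-of-rank-below m (rk w) (1≤rk w) (maximal w w⊑j w⊑u)
      ... | w″ , w″⊑m , rk≡ with w ≟ w″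
      ...   | yes refl = w″⊑m
      ...   | no w≢w″ with upper-cover-below-both w≢w″ (sym rk≡) w⊑j (⊑-trans w″⊑m m⊑j)
                                                   w⊑u (⊑-trans w″⊑m m⊑u)
      ...     | v , w⋖v , v⊑j , v⊑u =
        ⊑-trans (⋖⇒⊑ w⋖v) (ih (∸-monoʳ-< (⋖⇒rk< w⋖v) (maximal v v⊑j v⊑u)) v⊑j v⊑u)

  ¬¬-meet : x ⊑ j → x ⊑ u →
            ¬ ¬ (Σ[ m ∈ Carrier ] (m ⊑ j × m ⊑ u × (∀ w → w ⊑ j → w ⊑ u → w ⊑ m)))
  ¬¬-meet {j = j} {u = u} x⊑j x⊑u = do
    (m , (m⊑j , m⊑u) , maximal) ←
      ¬¬-maximal rk (λ w → w ⊑ j × w ⊑ u) (λ _ (w⊑j , _) → ⊑⇒rk≤ w⊑j) (x⊑j , x⊑u)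
    pure (m , m⊑j , m⊑u ,
          maximal-rank⇒greatest-common-lower-bound m⊑j m⊑u (λ w w⊑j w⊑u → maximal w (w⊑j , w⊑u)))

  -- If the meet m of j and u were below j, it would lie under c or c′, and so would y or x.
  separated⇒join : c ≢ c′ → c ⋖ j → c′ ⋖ j → x ⊑ c → ¬ x ⊑ c′ → y ⊑ c′ → ¬ y ⊑ c → IsJoin P x y j
  separated⇒join {c} {c′} {j} {x} {y} c≢c′ c⋖j c′⋖j x⊑c x⋢c′ y⊑c′ y⋢c = x⊑j , y⊑j , least
    where
      x⊑j : x ⊑ j
      x⊑j = ⊑-trans x⊑c (⋖⇒⊑ c⋖j)
      y⊑j : y ⊑ j
      y⊑j = ⊑-trans y⊑c′ (⋖⇒⊑ c′⋖j)
      least : ∀ u → x ⊑ u → y ⊑ u → j ⊑ u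
      least u x⊑u y⊑u = decidable-stable (j ⊑? u) (¬¬-map meet-is-j (¬¬-meet x⊑j x⊑u))
        where
          meet-is-j : Σ[ m ∈ Carrier ] (m ⊑ j × m ⊑ u × (∀ w → w ⊑ j → w ⊑ u → w ⊑ m)) → j ⊑ u
          meet-is-j (m , m⊑j , m⊑u , greatest) = subst (_⊑ u) (decidable-stable (m ≟ j) ¬m≢j) m⊑u
            where
              ¬m≢j : ¬ m ≢ j
              ¬m≢j m≢j = ¬¬-⊑-lower-cover (m⊑j , m≢j) λ (d , d⋖j , m⊑d) →
                [ (λ { refl → y⋢c (⊑-trans (greatest y y⊑j y⊑u) m⊑d) })
                , (λ { refl → x⋢c′ (⊑-trans (greatest x x⊑j x⊑u) m⊑d) })
                ] (lower-covers-exhaustive c≢c′ c⋖j c′⋖j d⋖j)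

  minimal-witness : ∀ a → ¬ a ⊑ c → Σ[ x ∈ Carrier ] (Minimal P x × x ⊑ a × ¬ x ⊑ c)
  minimal-witness {c} = measure-rec rk Witness search
    where
      Witness : Carrier → Set
      Witness a = ¬ a ⊑ c → Σ[ x ∈ Carrier ] (Minimal P x × x ⊑ a × ¬ x ⊑ c)
      lift : b ⋖ a → Σ[ x ∈ Carrier ] (Minimal P x × x ⊑ b × ¬ x ⊑ c) →
                     Σ[ x ∈ Carrier ] (Minimal P x × x ⊑ a × ¬ x ⊑ c)
      lift b⋖a (x , min , x⊑b , x⋢c) = x , min , ⊑-trans x⊑b (⋖⇒⊑ b⋖a) , x⋢c
      search : ∀ a → (∀ {b} → rk b < rk a → Witness b) → Witness a
      search a ih a⋢c with minimal? a
      ... | yes min = a , min , ⊑-refl , a⋢c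
      ... | no ¬min with lower-covers ¬min
      ...   | p , q , p≢q , p⋖a , q⋖a , _ with p ⊑? c | q ⊑? c
      ...     | yes p⊑c | yes q⊑c =
        ⊥-elim (a⋢c (proj₂ (proj₂ (lower-covers-join p≢q p⋖a q⋖a)) c p⊑c q⊑c))
      ...     | no p⋢c | _ = lift p⋖a (ih (⋖⇒rk< p⋖a) p⋢c)
      ...     | yes _ | no q⋢c = lift q⋖a (ih (⋖⇒rk< q⋖a) q⋢c)

  join-of-minimals : IsJoin P a b j → ¬ a ⊑ b → ¬ b ⊑ a →
    ¬ ¬ (Σ[ x ∈ Carrier ] Σ[ y ∈ Carrier ]
           (Minimal P x × Minimal P y × x ⊑ a × y ⊑ b × IsJoin P x y j))
  join-of-minimals {a} {b} {j} (a⊑j , b⊑j , least) a⋢b b⋢a = do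
    (c , c⋖j , a⊑c) ← ¬¬-⊑-lower-cover (a⊑j , λ { refl → b⋢a b⊑j })
    (c′ , c′⋖j , b⊑c′) ← ¬¬-⊑-lower-cover (b⊑j , λ { refl → a⋢b a⊑j })
    let (x , min-x , x⊑a , x⋢c′) = minimal-witness a (λ a⊑c′ → not-upper-bound c′⋖j a⊑c′ b⊑c′)
        (y , min-y , y⊑b , y⋢c) = minimal-witness b (λ b⊑c → not-upper-bound c⋖j a⊑c b⊑c)
        c≢c′ : c ≢ c′
        c≢c′ = λ { refl → not-upper-bound c⋖j a⊑c b⊑c′ }
    pure (x , y , min-x , min-y , x⊑a , y⊑b ,
          separated⇒join c≢c′ c⋖j c′⋖j (⊑-trans x⊑a a⊑c) x⋢c′ (⊑-trans y⊑b b⊑c′) y⋢c)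
    where
      not-upper-bound : c ⋖ j → a ⊑ c → b ⊑ c → ⊥
      not-upper-bound c⋖j a⊑c b⊑c = proj₂ (⋖⇒⊏ c⋖j) (⊑-antisym (⋖⇒⊑ c⋖j) (least _ a⊑c b⊑c))

lemma6p5 : (P Q : RankedPoset) → IsLRVine P → IsLRVine Q →
    (φ : RankedPoset.Carrier P → RankedPoset.Carrier Q) →
    IsHomomorphism P Q φ → RankPreserving P Q φ → PreservesMinimalJoins P Q φ →
    PreservesJoins P Q φ
lemma6p5 P Q lrP lrQ φ hom _ preserves a b j a∨b@(a⊑j , b⊑j , least) =
  hom a j a⊑j , hom b j b⊑j , φj-least
  where
    module P = LRVine P lrP
    module Q = LRVine Q lrQ
    open RankedPoset Q using (_⊑_)
    φj-least : ∀ u → φ a ⊑ u → φ b ⊑ u → φ j ⊑ u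
    φj-least u φa⊑u φb⊑u with a P.⊑? b | b P.⊑? a
    ... | yes a⊑b | _ = Q.⊑-trans (hom j b (least b a⊑b P.⊑-refl)) φb⊑u
    ... | no _ | yes b⊑a = Q.⊑-trans (hom j a (least a P.⊑-refl b⊑a)) φa⊑u
    ... | no a⋢b | no b⋢a =
      decidable-stable (φ j Q.⊑? u) (¬¬-map
        (λ (x , y , min-x , min-y , x⊑a , y⊑b , x∨y) →
          proj₂ (proj₂ (preserves x y j min-x min-y x∨y)) u
            (Q.⊑-trans (hom x a x⊑a) φa⊑u) (Q.⊑-trans (hom y b y⊑b) φb⊑u))
        (P.join-of-minimals a∨b a⋢b b⋢a))
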